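{- Suppose that $q$ is positive definite and primitive. Then with the restriction of $Q$ the quadratic lattice $L_q$ has discriminant $d$ and $[L_q]=-2[q]$.
   Context: Let $L'=\{(\begin{smallmatrix} -x & y \\ z & x\end{smallmatrix}) : x,y,z\in\mathbb{Z}\}$ with quadratic form $Q(X)=-\det X$ and bilinear form $(X,Y)=\tr(XY)$, oriented by the basis $(\begin{smallmatrix} -1 & \\ & 1\end{smallmatrix}),(\begin{smallmatrix} & 1\\ & \end{smallmatrix}),(\begin{smallmatrix} & \\ 1 & \end{smallmatrix})$. Let $q(x,y)=ax^2+bxy+cy^2$ be a positive definite integral binary quadratic form of discriminant $d$, let $X_q=(\begin{smallmatrix} -b & -2c\\ 2a & b\end{smallmatrix})$, and let $L_q=\{X\in L' : (X,X_q)=0\}$, a rank-2 lattice oriented so that $L_q\oplus\langle X_q\rangle$ has the orientation of $L'$. The form class group $\mathcal{C}_d^0$ (classes of primitive positive definite forms of discriminant $d$ modulo $\mathrm{PSL}_2(\mathbb{Z})$) is written additively. An oriented positive definite quadratic $\mathbb{Z}$-lattice $(\mathfrak{L},Q_{\mathfrak{L}})$ of rank 2 has class $[\mathfrak{L}]$ given by the form $Q_{\mathfrak{L}}(x\lambda_1+y\lambda_2)$ for a positively oriented basis $\lambda_1,\lambda_2$, and its (signed) discriminant is $-4\det Q_{\mathfrak{L}}(\lambda)$ where $Q_{\mathfrak{L}}(\lambda)$ is the half Gram matrix. -}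

module Defs where

open import Data.Integer using (ℤ; +_; -_; _+_; _-_; _*_; _<_; _>_)
open import Data.Integer.Divisibility using (_∣_)
open import Data.Product using (Σ; _×_; _,_; ∃; ∃-syntax)
open import Relation.Binary.PropositionalEquality using (_≡_)

-- Integral binary quadratic forms  a x² + b x y + c y²

record Form : Set where
  constructor form
  field
    a b c : ℤ
open Form public

disc : Form → ℤ
disc f = b f * b f - + 4 * a f * c f

PosDef : Form → Set
PosDef f = (a f > + 0) × (disc f < + 0)

Primitive : Form → Set
Primitive f = ∀ k → k ∣ a f → k ∣ b f → k ∣ c f → k ∣ + 1

evalF : Form → ℤ → ℤ → ℤ
evalF f x y = a f * x * x + b f * x * y + c f * y * y

-- f acted on by M = (p q ; r s):  (f·M)(x,y) = f(p x + q y, r x + s y)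
act : Form → ℤ → ℤ → ℤ → ℤ → Form
act f p q r s =
  form (evalF f p r)
       (+ 2 * a f * p * q + b f * (p * s + q * r) + + 2 * c f * r * s)
       (evalF f q s)

_∼_ : Form → Form → Set
f ∼ g = ∃[ p ] ∃[ q ] ∃[ r ] ∃[ s ] ((p * s - q * r ≡ + 1) × (act f p q r s ≡ g))

-- Dirichlet composition of two "united" forms f₁ = (a₁,b₁,c₁), f₂ = (a₂,b₂,c₂)
-- of the same discriminant D with gcd(a₁,a₂,(b₁+b₂)/2) = 1:
-- the form (a₁a₂, B, C) with B ≡ b₁ mod 2a₁, B ≡ b₂ mod 2a₂, B² - 4a₁a₂C = D.
DirichletComp : Form → Form → Form → Set
DirichletComp f₁ f₂ f₃ =
  (disc f₁ ≡ disc f₂) ×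
  (∀ k → k ∣ a f₁ → k ∣ a f₂ → (k * + 2) ∣ (b f₁ + b f₂) → k ∣ + 1) ×
  (a f₃ ≡ a f₁ * a f₂) ×
  ((+ 2 * a f₁) ∣ (b f₃ - b f₁)) ×
  ((+ 2 * a f₂) ∣ (b f₃ - b f₂)) ×
  (disc f₃ ≡ disc f₁)

-- [f₃] = [f₁] + [f₂] in the form class group
IsComp : Form → Form → Form → Set
IsComp f₁ f₂ f₃ =
  ∃[ g₁ ] ∃[ g₂ ] ∃[ g₃ ] ((f₁ ∼ g₁) × (f₂ ∼ g₂) × DirichletComp g₁ g₂ g₃ × (g₃ ∼ f₃))

-- the opposite form, representing the inverse class -[f]
opp : Form → Form
opp f = form (a f) (- b f) (c f)

-- The lattice L' = { (-x y ; z x) }, with coordinates (x,y,z) w.r.t. the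
-- oriented basis (-1 0;0 1), (0 1;0 0), (0 0;1 0).

record V3 : Set where
  constructor v3
  field
    x y z : ℤ
open V3 public

Mat : Set
Mat = ℤ × ℤ × ℤ × ℤ   -- entries (m11, m12, m21, m22)

toMat : V3 → Mat
toMat v = (- x v , y v , z v , x v)

det2 : Mat → ℤ
det2 (m11 , m12 , m21 , m22) = m11 * m22 - m12 * m21

tr2 : Mat → ℤ
tr2 (m11 , m12 , m21 , m22) = m11 + m22

mul2 : Mat → Mat → Mat
mul2 (a11 , a12 , a21 , a22) (b11 , b12 , b21 , b22) =
  ( a11 * b11 + a12 * b21 , a11 * b12 + a12 * b22
  , a21 * b11 + a22 * b21 , a21 * b12 + a22 * b22 )

Qv : V3 → ℤ
Qv v = - det2 (toMat v)

bil : V3 → V3 → ℤ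
bil u v = tr2 (mul2 (toMat u) (toMat v))

_+v_ : V3 → V3 → V3
u +v v = v3 (x u + x v) (y u + y v) (z u + z v)

_·v_ : ℤ → V3 → V3
k ·v v = v3 (k * x v) (k * y v) (k * z v)

det3 : V3 → V3 → V3 → ℤ
det3 u v w =
    x u * (y v * z w - z v * y w)
  - y u * (x v * z w - z v * x w)
  + z u * (x v * y w - y v * x w)

-- X_q = (-b -2c ; 2a b), i.e. coordinates (b, -2c, 2a)
Xq : Form → V3
Xq f = v3 (b f) (- (+ 2 * c f)) (+ 2 * a f)

InLq : Form → V3 → Set
InLq f v = bil v (Xq f) ≡ + 0

PosBasisLq : Form → V3 → V3 → Set
PosBasisLq f l₁ l₂ =
  InLq f l₁ × InLq f l₂ ×
  (∀ v → InLq f v → ∃[ m ] ∃[ n ] (v ≡ (m ·v l₁) +v (n ·v l₂))) ×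
  (det3 l₁ l₂ (Xq f) > + 0)

latticeForm : V3 → V3 → Form
latticeForm l₁ l₂ = form (Qv l₁) (bil l₁ l₂) (Qv l₂)

-- signed discriminant of a rank-2 lattice with basis λ₁, λ₂:
-- -4 det of the half Gram matrix ( Q(λ₁)  (λ₁,λ₂)/2 ; (λ₁,λ₂)/2  Q(λ₂) ),
-- i.e. (λ₁,λ₂)² - 4 Q(λ₁) Q(λ₂)
latticeDisc : V3 → V3 → ℤ
latticeDisc l₁ l₂ = bil l₁ l₂ * bil l₁ l₂ - + 4 * Qv l₁ * Qv l₂

module Submission where

-- Since q is primitive there is an r with gcd(a, b + cr) = 1; fix u, v with
-- u a + v (b + cr) = 1. Then q and its shear q(x, rx + y) are united, and their
-- Dirichlet composite s can be written down explicitly. The vectors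
-- ω₁ = (a, −(b + cr), −ra) and ω₂ = (cv, cu, 1 − rcv) lie in L_q, their cross
-- product is (−b, −a, c), and Q restricted to them is the opposite of s.
-- A positive basis of L_q differs from (ω₁, ω₂) by an integral matrix whose
-- determinant divides a, b and c, hence is ±1, and is positive by the
-- orientation, so the two bases give properly equivalent forms. The
-- discriminant of a plane in L′ only depends on the cross product of a basis.

open import Defs
open import Data.Integer
  using (ℤ; +_; -[1+_]; -_; _+_; _-_; _*_; _<_; _>_; +<+; ∣_∣; 0ℤ; 1ℤ)
open import Data.Integer.Divisibility using (_∣_; *-cancelʳ-∣)
import Data.Integer.Divisibility.Signed as Signed
open import Data.Integer.GCD using (gcd; gcd[i,j]∣i; gcd[i,j]∣j)
open import Data.Integer.Properties using (pos-+; pos-*; +-comm; ∣-i∣≡∣i∣; *-identityˡ; neg-mono-<)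
open import Data.Integer.Tactic.RingSolver using (solve-∀)
import Data.Nat as ℕ
import Data.Nat.Divisibility as ℕ
import Data.Nat.GCD as ℕ
open import Data.Nat.Induction using (<-rec)
open import Data.Product using (_×_; _,_; ∃-syntax)
open import Relation.Binary.PropositionalEquality
open import Relation.Nullary.Negation using (contradiction)
open ≡-Reasoning

BézoutCoprime : ℤ → ℤ → Set
BézoutCoprime i j = ∃[ u ] ∃[ v ] (u * i + v * j ≡ 1ℤ)

bézout-ℕ : ∀ m n → ∃[ u ] ∃[ v ] (u * + m + v * + n ≡ + ℕ.gcd m n)
bézout-ℕ m n = fromIdentity (ℕ.Bézout.identity (ℕ.gcd-GCD m n))
  where
  lift : ∀ d s k t l → d ℕ.+ s ℕ.* k ≡ t ℕ.* l → + t * + l + - + s * + k ≡ + d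
  lift d s k t l eq = begin
    + t * + l + - + s * + k           ≡⟨ cong (λ w → w + - + s * + k) (pos-* t l) ⟨
    + (t ℕ.* l) + - + s * + k         ≡⟨ cong (λ w → + w + - + s * + k) eq ⟨
    + (d ℕ.+ s ℕ.* k) + - + s * + k   ≡⟨ cong (λ w → w + - + s * + k) (pos-+ d (s ℕ.* k)) ⟩
    + d + + (s ℕ.* k) + - + s * + k   ≡⟨ cong (λ w → + d + w + - + s * + k) (pos-* s k) ⟩
    + d + + s * + k + - + s * + k     ≡⟨ cancel (+ d) (+ s) (+ k) ⟩
    + d                               ∎
    where
    cancel : ∀ d s k → d + s * k + - s * k ≡ d
    cancel = solve-∀
  fromIdentity : ∀ {d} → ℕ.Bézout.Identity d m n → ∃[ u ] ∃[ v ] (u * + m + v * + n ≡ + d)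
  fromIdentity (ℕ.Bézout.+- x y eq) = + x , - + y , lift _ y n x m eq
  fromIdentity (ℕ.Bézout.-+ x y eq) =
    - + x , + y , trans (+-comm (- + x * + m) (+ y * + n)) (lift _ x m y n eq)

*∣i∣-absorb : ∀ u i → ∃[ u′ ] (u * + ∣ i ∣ ≡ u′ * i)
*∣i∣-absorb u (+ n)    = u , refl
*∣i∣-absorb u -[1+ n ] = - u , neg-neg u (+ ℕ.suc n)
  where
  neg-neg : ∀ u m → u * m ≡ - u * - m
  neg-neg = solve-∀

bézout : ∀ i j → ∃[ u ] ∃[ v ] (u * i + v * j ≡ gcd i j)
bézout i j with bézout-ℕ ∣ i ∣ ∣ j ∣
... | u , v , eq with *∣i∣-absorb u i | *∣i∣-absorb v j
...   | u′ , u≡ | v′ , v≡ = u′ , v′ , trans (cong₂ _+_ (sym u≡) (sym v≡)) eq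

gcd≡1⇒bézoutCoprime : ∀ {i j} → gcd i j ≡ 1ℤ → BézoutCoprime i j
gcd≡1⇒bézoutCoprime {i} {j} gcd≡1 with bézout i j
... | u , v , eq = u , v , trans eq gcd≡1

*≡⇒∣ : ∀ {k i j} → k * i ≡ j → k ∣ j
*≡⇒∣ {k} {i} refl = Signed.∣⇒∣ᵤ (Signed.∣m⇒∣m*n i (Signed.∣-refl {k}))

∣-neg : ∀ {k j} → k ∣ - j → k ∣ j
∣-neg {k} {j} = subst (ℕ._∣_ ∣ k ∣) (∣-i∣≡∣i∣ j)

∣1∧0<k*i⇒≡1 : ∀ {k i} → k ∣ 1ℤ → 0ℤ < i → 0ℤ < k * i → k ≡ 1ℤ
∣1∧0<k*i⇒≡1 {+ n} k∣1 _ _ with ℕ.∣1⇒≡1 k∣1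
... | refl = refl
∣1∧0<k*i⇒≡1 { -[1+ _ ]} {+ 0} _ (+<+ ()) _
∣1∧0<k*i⇒≡1 { -[1+ _ ]} {+ ℕ.suc _} _ _ ()

bézoutCoprime⇒∣1 : ∀ {i j k} → BézoutCoprime i j → k ∣ i → k ∣ j → k ∣ 1ℤ
bézoutCoprime⇒∣1 {k = k} (u , v , eq) k∣i k∣j = Signed.∣⇒∣ᵤ (subst (Signed._∣_ k) eq
  (Signed.∣m∣n⇒∣m+n (Signed.∣n⇒∣m*n u (Signed.∣ᵤ⇒∣ k∣i))
                    (Signed.∣n⇒∣m*n v (Signed.∣ᵤ⇒∣ k∣j))))

bézoutCoprime-* : ∀ {i j k} → BézoutCoprime i k → BézoutCoprime j k → BézoutCoprime (i * j) k
bézoutCoprime-* {i} {j} {k} (u , v , eq) (u′ , v′ , eq′) =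
  u * u′ , u * i * v′ + v * (u′ * j + v′ * k) , (begin
    u * u′ * (i * j) + (u * i * v′ + v * (u′ * j + v′ * k)) * k ≡⟨ expand u u′ v v′ i j k ⟩
    (u * i + v * k) * (u′ * j + v′ * k)                          ≡⟨ cong₂ _*_ eq eq′ ⟩
    1ℤ                                                            ∎)
  where
  expand : ∀ u u′ v v′ i j k →
    u * u′ * (i * j) + (u * i * v′ + v * (u′ * j + v′ * k)) * k ≡ (u * i + v * k) * (u′ * j + v′ * k)
  expand = solve-∀

bézoutCoprime-+-multiple : ∀ {i j k} r → i Signed.∣ k → BézoutCoprime i j → BézoutCoprime i (j + k * r)
bézoutCoprime-+-multiple {i} {j} r (Signed.divides k refl) (u , v , eq) =
  u - v * k * r , v , trans (expand u v k r i j) eq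
  where
  expand : ∀ u v k r i j → (u - v * k * r) * i + v * (j + k * i * r) ≡ u * i + v * j
  expand = solve-∀

bézoutCoprime⇒coprime-shift : ∀ {a c} b → BézoutCoprime a c → ∃[ r ] BézoutCoprime a (b + c * r)
bézoutCoprime⇒coprime-shift {a} {c} b (u , v , eq) = v * (1ℤ - b) , u * (1ℤ - b) , 1ℤ , (begin
  u * (1ℤ - b) * a + 1ℤ * (b + c * (v * (1ℤ - b))) ≡⟨ expand u v a b c ⟩
  (1ℤ - b) * (u * a + v * c) + b                    ≡⟨ cong (λ t → (1ℤ - b) * t + b) eq ⟩
  (1ℤ - b) * 1ℤ + b                                 ≡⟨ simplify b ⟩
  1ℤ                                                ∎)
  where
  expand : ∀ u v a b c → u * (1ℤ - b) * a + 1ℤ * (b + c * (v * (1ℤ - b))) ≡ (1ℤ - b) * (u * a + v * c) + b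
  expand = solve-∀
  simplify : ∀ b → (1ℤ - b) * 1ℤ + b ≡ 1ℤ
  simplify = solve-∀

primitive⇒bézoutCoprime : ∀ {a b c k} → Primitive (form a b c) → k ∣ a → k ∣ c → BézoutCoprime k b
primitive⇒bézoutCoprime {b = b} {k = k} prim k∣a k∣c = gcd≡1⇒bézoutCoprime (cong +_ (ℕ.∣1⇒≡1
  (prim (gcd k b) (ℕ.∣-trans (gcd[i,j]∣i k b) k∣a) (gcd[i,j]∣j k b) (ℕ.∣-trans (gcd[i,j]∣i k b) k∣c))))

-- If d = gcd(a, c) > 1, recurse on a/d: b + cr stays coprime to d because d ∣ c
-- and d is coprime to b.
primitive⇒coprime-shift : ∀ {a b c} → a > 0ℤ → Primitive (form a b c) →
  ∃[ r ] BézoutCoprime a (b + c * r)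
primitive⇒coprime-shift {+ 0} (+<+ ())
primitive⇒coprime-shift {+ ℕ.suc n} {b} {c} _ = <-rec P step (ℕ.suc n) b c
  where
  P : ℕ.ℕ → Set
  P n = .{{_ : ℕ.NonZero n}} → ∀ b c → Primitive (form (+ n) b c) → ∃[ r ] BézoutCoprime (+ n) (b + c * r)
  step : ∀ n → (∀ {m} → m ℕ.< n → P m) → P n
  step n rec b c prim with ℕ.gcd n ∣ c ∣ in gcd≡d
  ... | 0 = contradiction (ℕ.gcd[m,n]≡0⇒m≡0 gcd≡d) (ℕ.≢-nonZero⁻¹ n)
  ... | 1 = bézoutCoprime⇒coprime-shift b (gcd≡1⇒bézoutCoprime {+ n} {c} (cong +_ gcd≡d))
  ... | d@(ℕ.suc (ℕ.suc _)) =
    coprime-n (rec (ℕ.quotient-< d∣n) {{ℕ.quotient≢0 d∣n}} b c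
                   (λ k k∣q → prim k (ℕ.∣-trans k∣q (ℕ.quotient-∣ d∣n))))
    where
    d∣n : d ℕ.∣ n
    d∣n = subst (ℕ._∣ n) gcd≡d (ℕ.gcd[m,n]∣m n ∣ c ∣)
    d∣c : d ℕ.∣ ∣ c ∣
    d∣c = subst (ℕ._∣ ∣ c ∣) gcd≡d (ℕ.gcd[m,n]∣n n ∣ c ∣)
    n≡q*d : + n ≡ + ℕ.quotient d∣n * + d
    n≡q*d = trans (cong +_ (ℕ.m∣n⇒n≡quotient*m d∣n)) (pos-* (ℕ.quotient d∣n) d)
    coprime-n : ∃[ r ] BézoutCoprime (+ ℕ.quotient d∣n) (b + c * r) →
                ∃[ r ] BézoutCoprime (+ n) (b + c * r)
    coprime-n (r , coprime-q) = r , subst (λ t → BézoutCoprime t (b + c * r)) (sym n≡q*d)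
      (bézoutCoprime-* coprime-q (bézoutCoprime-+-multiple {j = b} r (Signed.∣ᵤ⇒∣ {+ d} {c} d∣c)
        (primitive⇒bézoutCoprime {+ n} {b} {c} {+ d} prim d∣n d∣c)))

form-≡ : ∀ {a b c a′ b′ c′} → a ≡ a′ → b ≡ b′ → c ≡ c′ → form a b c ≡ form a′ b′ c′
form-≡ refl refl refl = refl

∼-refl : ∀ f → f ∼ f
∼-refl (form a b c) = 1ℤ , 0ℤ , 0ℤ , 1ℤ , refl , form-≡ (first a b c) (middle a b c) (last a b c)
  where
  first : ∀ a b c → a * 1ℤ * 1ℤ + b * 1ℤ * 0ℤ + c * 0ℤ * 0ℤ ≡ a
  first = solve-∀
  middle : ∀ a b c → + 2 * a * 1ℤ * 0ℤ + b * (1ℤ * 1ℤ + 0ℤ * 0ℤ) + + 2 * c * 0ℤ * 1ℤ ≡ b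
  middle = solve-∀
  last : ∀ a b c → a * 0ℤ * 0ℤ + b * 0ℤ * 1ℤ + c * 1ℤ * 1ℤ ≡ c
  last = solve-∀

shear : Form → ℤ → Form
shear (form a b c) r = form (a + b * r + c * r * r) (b + + 2 * c * r) c

∼-shear : ∀ f r → f ∼ shear f r
∼-shear (form a b c) r = 1ℤ , 0ℤ , r , 1ℤ , det r , form-≡ (first a b c r) (middle a b c r) (last a b c r)
  where
  det : ∀ r → 1ℤ * 1ℤ - 0ℤ * r ≡ 1ℤ
  det = solve-∀
  first : ∀ a b c r → a * 1ℤ * 1ℤ + b * 1ℤ * r + c * r * r ≡ a + b * r + c * r * r
  first = solve-∀
  middle : ∀ a b c r → + 2 * a * 1ℤ * 0ℤ + b * (1ℤ * 1ℤ + 0ℤ * r) + + 2 * c * r * 1ℤ ≡ b + + 2 * c * r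
  middle = solve-∀
  last : ∀ a b c r → a * 0ℤ * 0ℤ + b * 0ℤ * 1ℤ + c * 1ℤ * 1ℤ ≡ c
  last = solve-∀

disc-shear : ∀ f r → disc (shear f r) ≡ disc f
disc-shear (form a b c) r = expand a b c r
  where
  expand : ∀ a b c r →
    (b + + 2 * c * r) * (b + + 2 * c * r) - + 4 * (a + b * r + c * r * r) * c ≡ b * b - + 4 * a * c
  expand = solve-∀

v3-≡ : ∀ {x y z x′ y′ z′} → x ≡ x′ → y ≡ y′ → z ≡ z′ → v3 x y z ≡ v3 x′ y′ z′
v3-≡ refl refl refl = refl

cross : V3 → V3 → V3
cross u v = v3 (y u * z v - z u * y v) (z u * x v - x u * z v) (x u * y v - y u * x v)

dot : V3 → V3 → ℤ
dot u v = x u * x v + y u * y v + z u * z v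

Qv-combination : ∀ p r u v → Qv ((p ·v u) +v (r ·v v)) ≡ evalF (latticeForm u v) p r
Qv-combination p r (v3 x₁ y₁ z₁) (v3 x₂ y₂ z₂) = expand p r x₁ y₁ z₁ x₂ y₂ z₂
  where
  -- Q and B spell out Qv and bil in coordinates: the ring solver only sees
  -- through ring operations.
  expand : ∀ p r x₁ y₁ z₁ x₂ y₂ z₂ →
    let Q : ℤ → ℤ → ℤ → ℤ
        Q x y z = - (- x * x - y * z)
        B : ℤ → ℤ → ℤ → ℤ → ℤ → ℤ → ℤ
        B x y z x′ y′ z′ = - x * - x′ + y * z′ + (z * y′ + x * x′)
    in Q (p * x₁ + r * x₂) (p * y₁ + r * y₂) (p * z₁ + r * z₂)
       ≡ Q x₁ y₁ z₁ * p * p + B x₁ y₁ z₁ x₂ y₂ z₂ * p * r + Q x₂ y₂ z₂ * r * r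
  expand = solve-∀

bil-combination : ∀ p q r s u v →
  bil ((p ·v u) +v (r ·v v)) ((q ·v u) +v (s ·v v))
    ≡ + 2 * Qv u * p * q + bil u v * (p * s + q * r) + + 2 * Qv v * r * s
bil-combination p q r s (v3 x₁ y₁ z₁) (v3 x₂ y₂ z₂) = expand p q r s x₁ y₁ z₁ x₂ y₂ z₂
  where
  expand : ∀ p q r s x₁ y₁ z₁ x₂ y₂ z₂ →
    let Q : ℤ → ℤ → ℤ → ℤ
        Q x y z = - (- x * x - y * z)
        B : ℤ → ℤ → ℤ → ℤ → ℤ → ℤ → ℤ
        B x y z x′ y′ z′ = - x * - x′ + y * z′ + (z * y′ + x * x′)
    in B (p * x₁ + r * x₂) (p * y₁ + r * y₂) (p * z₁ + r * z₂)
         (q * x₁ + s * x₂) (q * y₁ + s * y₂) (q * z₁ + s * z₂)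
       ≡ + 2 * Q x₁ y₁ z₁ * p * q + B x₁ y₁ z₁ x₂ y₂ z₂ * (p * s + q * r) + + 2 * Q x₂ y₂ z₂ * r * s
  expand = solve-∀

latticeForm-act : ∀ u v p q r s →
  act (latticeForm u v) p q r s ≡ latticeForm ((p ·v u) +v (r ·v v)) ((q ·v u) +v (s ·v v))
latticeForm-act u v p q r s =
  sym (form-≡ (Qv-combination p r u v) (bil-combination p q r s u v) (Qv-combination q s u v))

cross-basis-change : ∀ p q r s u v →
  cross ((p ·v u) +v (r ·v v)) ((q ·v u) +v (s ·v v)) ≡ (p * s - q * r) ·v cross u v
cross-basis-change p q r s (v3 x₁ y₁ z₁) (v3 x₂ y₂ z₂) =
  v3-≡ (minor p q r s y₁ z₁ y₂ z₂) (minor p q r s z₁ x₁ z₂ x₂) (minor p q r s x₁ y₁ x₂ y₂)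
  where
  minor : ∀ p q r s m₁ n₁ m₂ n₂ →
    (p * m₁ + r * m₂) * (q * n₁ + s * n₂) - (p * n₁ + r * n₂) * (q * m₁ + s * m₂)
      ≡ (p * s - q * r) * (m₁ * n₂ - n₁ * m₂)
  minor = solve-∀

det3≡dot-cross : ∀ u v w → det3 u v w ≡ dot (cross u v) w
det3≡dot-cross (v3 x₁ y₁ z₁) (v3 x₂ y₂ z₂) (v3 x₃ y₃ z₃) = expand x₁ y₁ z₁ x₂ y₂ z₂ x₃ y₃ z₃
  where
  expand : ∀ x₁ y₁ z₁ x₂ y₂ z₂ x₃ y₃ z₃ →
    x₁ * (y₂ * z₃ - z₂ * y₃) - y₁ * (x₂ * z₃ - z₂ * x₃) + z₁ * (x₂ * y₃ - y₂ * x₃)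
      ≡ (y₁ * z₂ - z₁ * y₂) * x₃ + (z₁ * x₂ - x₁ * z₂) * y₃ + (x₁ * y₂ - y₁ * x₂) * z₃
  expand = solve-∀

dot-·v : ∀ k u w → dot (k ·v u) w ≡ k * dot u w
dot-·v k (v3 x₁ y₁ z₁) (v3 x₂ y₂ z₂) = expand k x₁ y₁ z₁ x₂ y₂ z₂
  where
  expand : ∀ k x₁ y₁ z₁ x₂ y₂ z₂ →
    k * x₁ * x₂ + k * y₁ * y₂ + k * z₁ * z₂ ≡ k * (x₁ * x₂ + y₁ * y₂ + z₁ * z₂)
  expand = solve-∀

-- Minus the quadratic form of the adjugate of the Gram matrix of bil.
adjQ : V3 → ℤ
adjQ w = x w * x w + + 4 * y w * z w

latticeDisc≡adjQ-cross : ∀ u v → latticeDisc u v ≡ adjQ (cross u v)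
latticeDisc≡adjQ-cross (v3 x₁ y₁ z₁) (v3 x₂ y₂ z₂) = expand x₁ y₁ z₁ x₂ y₂ z₂
  where
  expand : ∀ x₁ y₁ z₁ x₂ y₂ z₂ →
    let Q : ℤ → ℤ → ℤ → ℤ
        Q x y z = - (- x * x - y * z)
        B = - x₁ * - x₂ + y₁ * z₂ + (z₁ * y₂ + x₁ * x₂)
        n₁ = y₁ * z₂ - z₁ * y₂
    in B * B - + 4 * Q x₁ y₁ z₁ * Q x₂ y₂ z₂
       ≡ n₁ * n₁ + + 4 * (z₁ * x₂ - x₁ * z₂) * (x₁ * y₂ - y₁ * x₂)
  expand = solve-∀

normal : Form → V3
normal f = v3 (- b f) (- a f) (c f)

dot-normal≡0⇒InLq : ∀ f w → dot (normal f) w ≡ 0ℤ → InLq f w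
dot-normal≡0⇒InLq (form a b c) (v3 x y z) eq = trans (expand a b c x y z) (cong (_*_ (- + 2)) eq)
  where
  expand : ∀ a b c x y z →
    - x * - b + y * (+ 2 * a) + (z * - (+ 2 * c) + x * b) ≡ - + 2 * (- b * x + - a * y + c * z)
  expand = solve-∀

dot-normal-Xq : ∀ f → dot (normal f) (Xq f) ≡ - disc f
dot-normal-Xq (form a b c) = expand a b c
  where
  expand : ∀ a b c → - b * b + - a * - (+ 2 * c) + c * (+ 2 * a) ≡ - (b * b - + 4 * a * c)
  expand = solve-∀

adjQ-normal : ∀ f → adjQ (normal f) ≡ disc f
adjQ-normal (form a b c) = expand a b c
  where
  expand : ∀ a b c → - b * - b + + 4 * - a * c ≡ b * b - + 4 * a * c
  expand = solve-∀

·v-identity : ∀ w → 1ℤ ·v w ≡ w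
·v-identity w = v3-≡ (*-identityˡ (x w)) (*-identityˡ (y w)) (*-identityˡ (z w))

scaled-normal⇒∣1 : ∀ {f k} w → Primitive f → k ·v w ≡ normal f → k ∣ 1ℤ
scaled-normal⇒∣1 {f} {k} w prim eq = prim k
  (∣-neg {k} {a f} (*≡⇒∣ {k} {y w} (cong y eq)))
  (∣-neg {k} {b f} (*≡⇒∣ {k} {x w} (cong x eq)))
  (*≡⇒∣ {k} {z w} (cong z eq))

basisChange-det≡1 : ∀ {f l₁ l₂} p q r s → Primitive f → disc f < 0ℤ → det3 l₁ l₂ (Xq f) > 0ℤ →
  cross ((p ·v l₁) +v (r ·v l₂)) ((q ·v l₁) +v (s ·v l₂)) ≡ normal f →
  (p * s - q * r ≡ 1ℤ) × (cross l₁ l₂ ≡ normal f)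
basisChange-det≡1 {f} {l₁} {l₂} p q r s prim disc<0 oriented cross≡normal = Δ≡1 , (begin
  cross l₁ l₂      ≡⟨ ·v-identity (cross l₁ l₂) ⟨
  1ℤ ·v cross l₁ l₂ ≡⟨ cong (_·v cross l₁ l₂) Δ≡1 ⟨
  Δ ·v cross l₁ l₂  ≡⟨ scaled ⟩
  normal f          ∎)
  where
  Δ : ℤ
  Δ = p * s - q * r
  scaled : Δ ·v cross l₁ l₂ ≡ normal f
  scaled = trans (sym (cross-basis-change p q r s l₁ l₂)) cross≡normal
  Δ*det3 : Δ * det3 l₁ l₂ (Xq f) ≡ - disc f
  Δ*det3 = begin
    Δ * det3 l₁ l₂ (Xq f)            ≡⟨ cong (Δ *_) (det3≡dot-cross l₁ l₂ (Xq f)) ⟩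
    Δ * dot (cross l₁ l₂) (Xq f)     ≡⟨ dot-·v Δ (cross l₁ l₂) (Xq f) ⟨
    dot (Δ ·v cross l₁ l₂) (Xq f)    ≡⟨ cong (λ w → dot w (Xq f)) scaled ⟩
    dot (normal f) (Xq f)            ≡⟨ dot-normal-Xq f ⟩
    - disc f                         ∎
  Δ≡1 : Δ ≡ 1ℤ
  Δ≡1 = ∣1∧0<k*i⇒≡1 {Δ} {det3 l₁ l₂ (Xq f)}
          (scaled-normal⇒∣1 {f} {Δ} (cross l₁ l₂) prim scaled)
          oriented
          (subst (0ℤ <_) (sym Δ*det3) (neg-mono-< disc<0))

PosBasisLq-normalPair : ∀ {f l₁ l₂} → Primitive f → disc f < 0ℤ → PosBasisLq f l₁ l₂ →
  ∀ ω₁ ω₂ → InLq f ω₁ → InLq f ω₂ → cross ω₁ ω₂ ≡ normal f →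
  (cross l₁ l₂ ≡ normal f) × (latticeForm l₁ l₂ ∼ latticeForm ω₁ ω₂)
PosBasisLq-normalPair {f} {l₁} {l₂} prim disc<0 (_ , _ , span , oriented) ω₁ ω₂ ω₁∈Lq ω₂∈Lq cross≡normal
  with span ω₁ ω₁∈Lq | span ω₂ ω₂∈Lq
... | p , r , ω₁≡ | q , s , ω₂≡ =
  equivalent (basisChange-det≡1 {f} {l₁} {l₂} p q r s prim disc<0 oriented
               (subst₂ (λ w₁ w₂ → cross w₁ w₂ ≡ normal f) ω₁≡ ω₂≡ cross≡normal))
  where
  equivalent : (p * s - q * r ≡ 1ℤ) × (cross l₁ l₂ ≡ normal f) →
    (cross l₁ l₂ ≡ normal f) × (latticeForm l₁ l₂ ∼ latticeForm ω₁ ω₂)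
  equivalent (det≡1 , cross-l≡normal) = cross-l≡normal ,
    (p , q , r , s , det≡1 , trans (latticeForm-act l₁ l₂ p q r s) (sym (cong₂ latticeForm ω₁≡ ω₂≡)))

latticeDisc≡disc : ∀ {f} l₁ l₂ → cross l₁ l₂ ≡ normal f → latticeDisc l₁ l₂ ≡ disc f
latticeDisc≡disc {f} l₁ l₂ cross≡normal = begin
  latticeDisc l₁ l₂     ≡⟨ latticeDisc≡adjQ-cross l₁ l₂ ⟩
  adjQ (cross l₁ l₂)    ≡⟨ cong adjQ cross≡normal ⟩
  adjQ (normal f)       ≡⟨ adjQ-normal f ⟩
  disc f                ∎

module DirichletSquare (a b c r u v : ℤ) (bézout-rel : u * a + v * (b + c * r) ≡ 1ℤ) where

  q : Form
  q = form a b c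

  B : ℤ
  B = b + + 2 * a * c * (r * u - v)

  square : Form
  square = form (a * (a + b * r + c * r * r)) B (c * (c * v * v + u - r * c * u * v))

  ω₁ : V3
  ω₁ = v3 a (- (b + c * r)) (- (r * a))

  ω₂ : V3
  ω₂ = v3 (c * v) (c * u) (1ℤ - r * c * v)

  modulo-rel : ∀ {i j} k → i ≡ j + k * (u * a + v * (b + c * r) - 1ℤ) → i ≡ j
  modulo-rel {i} {j} k eq = begin
    i                                             ≡⟨ eq ⟩
    j + k * (u * a + v * (b + c * r) - 1ℤ)        ≡⟨ cong (λ e → j + k * (e - 1ℤ)) bézout-rel ⟩
    j + k * (1ℤ - 1ℤ)                             ≡⟨ vanish j k ⟩
    j                                             ∎
    where
    vanish : ∀ j k → j + k * (1ℤ - 1ℤ) ≡ j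
    vanish = solve-∀

  ω₁∈Lq : InLq q ω₁
  ω₁∈Lq = dot-normal≡0⇒InLq q ω₁ (orthogonal a b c r)
    where
    orthogonal : ∀ a b c r → - b * a + - a * - (b + c * r) + c * - (r * a) ≡ 0ℤ
    orthogonal = solve-∀

  ω₂∈Lq : InLq q ω₂
  ω₂∈Lq = dot-normal≡0⇒InLq q ω₂ (modulo-rel (- c) (orthogonal a b c r u v))
    where
    orthogonal : ∀ a b c r u v →
      - b * (c * v) + - a * (c * u) + c * (1ℤ - r * c * v) ≡ 0ℤ + - c * (u * a + v * (b + c * r) - 1ℤ)
    orthogonal = solve-∀

  cross-ω : cross ω₁ ω₂ ≡ normal q
  cross-ω = v3-≡ (modulo-rel (r * c) (first a b c r u v)) (second a b c r u v) (modulo-rel c (third a b c r u v))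
    where
    first : ∀ a b c r u v →
      - (b + c * r) * (1ℤ - r * c * v) - - (r * a) * (c * u) ≡ - b + r * c * (u * a + v * (b + c * r) - 1ℤ)
    first = solve-∀
    second : ∀ a b c r u v → - (r * a) * (c * v) - a * (1ℤ - r * c * v) ≡ - a
    second = solve-∀
    third : ∀ a b c r u v →
      a * (c * u) - - (b + c * r) * (c * v) ≡ c + c * (u * a + v * (b + c * r) - 1ℤ)
    third = solve-∀

  latticeForm-ω : latticeForm ω₁ ω₂ ≡ opp square
  latticeForm-ω = form-≡ (first a b c r) (modulo-rel (c * r) (middle a b c r u v)) (last c r u v)
    where
    first : ∀ a b c r → - (- a * a - - (b + c * r) * - (r * a)) ≡ a * (a + b * r + c * r * r)
    first = solve-∀
    middle : ∀ a b c r u v →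
      - a * - (c * v) + - (b + c * r) * (1ℤ - r * c * v) + (- (r * a) * (c * u) + a * (c * v))
        ≡ - (b + + 2 * a * c * (r * u - v)) + c * r * (u * a + v * (b + c * r) - 1ℤ)
    middle = solve-∀
    last : ∀ c r u v → - (- (c * v) * (c * v) - c * u * (1ℤ - r * c * v)) ≡ c * (c * v * v + u - r * c * u * v)
    last = solve-∀

  united : ∀ k → k ∣ a → k ∣ a + b * r + c * r * r → (k * + 2) ∣ (b + (b + + 2 * c * r)) → k ∣ 1ℤ
  united k k∣a _ 2k∣b+b′ = bézoutCoprime⇒∣1 {a} {b + c * r} {k} (u , v , bézout-rel) k∣a
    (*-cancelʳ-∣ (+ 2) {k} {b + c * r} (subst ((k * + 2) ∣_) (twice b c r) 2k∣b+b′))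
    where
    twice : ∀ b c r → b + (b + + 2 * c * r) ≡ (b + c * r) * + 2
    twice = solve-∀

  dirichletComp : DirichletComp q (shear q r) square
  dirichletComp =
    sym (disc-shear q r) , united , refl ,
    *≡⇒∣ {+ 2 * a} {c * (r * u - v)} (B-b a b c r u v) ,
    *≡⇒∣ {+ 2 * (a + b * r + c * r * r)} { - (c * v)}
      (modulo-rel {j = B - (b + + 2 * c * r)} (- (+ 2 * c * r)) (B-b′ a b c r u v)) ,
    modulo-rel (+ 4 * a * c * (c * r * (r * u - v) - 1ℤ)) (disc-square a b c r u v)
    where
    B-b : ∀ a b c r u v → + 2 * a * (c * (r * u - v)) ≡ b + + 2 * a * c * (r * u - v) - b
    B-b = solve-∀
    B-b′ : ∀ a b c r u v →
      + 2 * (a + b * r + c * r * r) * - (c * v)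
        ≡ b + + 2 * a * c * (r * u - v) - (b + + 2 * c * r)
          + - (+ 2 * c * r) * (u * a + v * (b + c * r) - 1ℤ)
    B-b′ = solve-∀
    disc-square : ∀ a b c r u v →
      let B = b + + 2 * a * c * (r * u - v)
      in B * B - + 4 * (a * (a + b * r + c * r * r)) * (c * (c * v * v + u - r * c * u * v))
           ≡ b * b - + 4 * a * c
             + + 4 * a * c * (c * r * (r * u - v) - 1ℤ) * (u * a + v * (b + c * r) - 1ℤ)
    disc-square = solve-∀

  isComp : IsComp q q square
  isComp = q , shear q r , square , ∼-refl q , ∼-shear q r , dirichletComp , ∼-refl square

lemma4p5 : (q : Form) → PosDef q → Primitive q →
    (l₁ l₂ : V3) → PosBasisLq q l₁ l₂ →
      (latticeDisc l₁ l₂ ≡ disc q) ×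
      (∃[ r ] (IsComp q q r × (latticeForm l₁ l₂ ∼ opp r)))
lemma4p5 (form a b c) (a>0 , disc<0) prim l₁ l₂ basis
  with r , u , v , bézout-rel ← primitive⇒coprime-shift {a} {b} {c} a>0 prim =
  let open DirichletSquare a b c r u v bézout-rel
      cross≡normal , l∼ω = PosBasisLq-normalPair prim disc<0 basis ω₁ ω₂ ω₁∈Lq ω₂∈Lq cross-ω
  in  latticeDisc≡disc l₁ l₂ cross≡normal , square , isComp , subst (latticeForm l₁ l₂ ∼_) latticeForm-ω l∼ω
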